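{- Let $(G,t)$ be a rooted graph where $G$ is a 2-connected planar graph, and let $e,f,g$ be three links of $G$. Then: (1) if $f\in S_e$, then $e\notin S_f$; (2) if $f\in S_e$ and $g\in S_f$, then $g\in S_e$; (3) if $g\in S_e$ and $g\in S_f$, then $f\in S_e$ or $e\in S_f$.
   Context: Graphs are finite, simple, undirected; $t$ is a designated root node. 2-connected: every pair of nodes is joined by two internally node-disjoint paths. A link $\{u,v\}$ is separating if $G-\{u,v\}$ (removing both nodes) is disconnected. A separating link $\{u,v\}$ separates a node $w\notin\{u,v\}$ from $t$ if $w,t$ lie in different components of $G-\{u,v\}$, and separates a link $h\neq\{u,v\}$ from $t$ if it separates at least one endpoint of $h$ from $t$. For a separating link $e$ not incident to $t$, $S_e$ is the set of links separated from $t$ by $e$; for a separating link incident to $t$ or a non-separating link, $S_e=\emptyset$. The three links $e,f,g$ are understood to be distinct. -}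

module Defs where

open import Data.Nat using (ℕ; zero; suc; _+_; _*_)
open import Data.Fin using (Fin)
open import Data.Bool using (Bool; T)
open import Data.List using (List; []; _∷_; length; map; filterᵇ; allFin)
open import Data.Nat.ListAction using (sum)
open import Data.List.Membership.Propositional using (_∈_)
open import Data.List.Relation.Unary.Unique.Propositional using (Unique)
open import Data.Product using (Σ; ∃; _×_; _,_; proj₁; proj₂)
open import Data.Sum using (_⊎_)
open import Data.Empty using (⊥)
open import Relation.Nullary using (¬_)
open import Relation.Binary.PropositionalEquality using (_≡_)

record Graph : Set where
  field
    n      : ℕ
    adj    : Fin n → Fin n → Bool
    symm   : ∀ u v → adj u v ≡ adj v u
    irrefl : ∀ u → ¬ T (adj u u)

  Node : Set
  Node = Fin n

  Adj : Node → Node → Set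
  Adj u v = T (adj u v)

open Graph public

module _ (G : Graph) where
  private
    N = Node G

  data Chain : List N → Set where
    single : ∀ x → Chain (x ∷ [])
    cons   : ∀ x y xs → Adj G x y → Chain (y ∷ xs) → Chain (x ∷ y ∷ xs)

  last : N → List N → N
  last x []       = x
  last x (y ∷ ys) = last y ys

  IsPath : N → N → List N → Set
  IsPath u v []       = ⊥
  IsPath u v (x ∷ xs) = Chain (x ∷ xs) × Unique (x ∷ xs) × x ≡ u × last x xs ≡ v

  InternallyDisjoint : N → N → List N → List N → Set
  InternallyDisjoint u v P Q = ∀ w → w ∈ P → w ∈ Q → (w ≡ u) ⊎ (w ≡ v)

  TwoConnected : Set
  TwoConnected = ∀ u v → ¬ u ≡ v →
    Σ (List N) λ P → Σ (List N) λ Q →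
      IsPath u v P × IsPath u v Q × ¬ P ≡ Q × InternallyDisjoint u v P Q

  -- Links (edges): an adjacent pair, understood as unordered.

  record Link : Set where
    constructor link
    field
      end₁ end₂ : N
      isAdj     : Adj G end₁ end₂
  open Link public

  SameLink : Link → Link → Set
  SameLink h e = (end₁ h ≡ end₁ e × end₂ h ≡ end₂ e)
               ⊎ (end₁ h ≡ end₂ e × end₂ h ≡ end₁ e)

  IncidentTo : N → Link → Set
  IncidentTo w e = (w ≡ end₁ e) ⊎ (w ≡ end₂ e)

  data WalkAvoiding (a b : N) : N → N → Set where
    here : ∀ {x} → ¬ x ≡ a → ¬ x ≡ b → WalkAvoiding a b x x
    step : ∀ {x y z} → ¬ x ≡ a → ¬ x ≡ b → Adj G x y →
           WalkAvoiding a b y z → WalkAvoiding a b x z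

  -- x and y lie in the same component of G - {a,b}  (both must be nodes of it)
  ConnectedIn- : N → N → N → N → Set
  ConnectedIn- a b x y = WalkAvoiding a b x y

  Separating : Link → Set
  Separating e = Σ N λ x → Σ N λ y →
    ¬ IncidentTo x e × ¬ IncidentTo y e ×
    ¬ ConnectedIn- (end₁ e) (end₂ e) x y

  SeparatesNode : N → Link → N → Set
  SeparatesNode t e w = Separating e × ¬ IncidentTo w e × ¬ IncidentTo t e ×
    ¬ ConnectedIn- (end₁ e) (end₂ e) w t

  SeparatesLink : N → Link → Link → Set
  SeparatesLink t e h = ¬ SameLink h e ×
    (SeparatesNode t e (end₁ h) ⊎ SeparatesNode t e (end₂ h))

  -- h ∈ S_e  (S_e = ∅ when e is non-separating or incident to t)
  InS : N → Link → Link → Set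
  InS t e h = Separating e × ¬ IncidentTo t e × SeparatesLink t e h

  -- Planarity (combinatorial, for connected graphs): a rotation system
  -- whose face count satisfies Euler's formula V - E + F = 2
  -- (Heffter–Edmonds–Ringel embedding of a connected graph in the sphere).

  iter : {A : Set} → (A → A) → ℕ → A → A
  iter f zero    x = x
  iter f (suc k) x = f (iter f k x)

  Dart : Set
  Dart = Σ (N × N) λ p → Adj G (proj₁ p) (proj₂ p)

  -- number of darts = 2|E|
  dartCount : ℕ
  dartCount = sum (map (λ u → length (filterᵇ (adj G u) (allFin (n G)))) (allFin (n G)))

  record RotationSystem : Set where
    field
      ρ       : N → N → N          -- ρ v u : neighbour of v following u
      ρ-adj   : ∀ v u → Adj G v u → Adj G v (ρ v u)
      ρ-inj   : ∀ v u w → Adj G v u → Adj G v w → ρ v u ≡ ρ v w → u ≡ w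
      ρ-cycle : ∀ v u w → Adj G v u → Adj G v w → ∃ λ k → iter (ρ v) k u ≡ w

    -- face permutation on darts: (u,v) ↦ (v, ρ v u)
    φ : Dart → Dart
    φ ((u , v) , a) = (v , ρ v u) , ρ-adj v u (subst-adj u v a)
      where
        subst-adj : ∀ u v → Adj G u v → Adj G v u
        subst-adj u v a rewrite symm G v u = a

    SameFace : Dart → Dart → Set
    SameFace d d' = ∃ λ k → proj₁ (iter φ k d) ≡ proj₁ d'

    FaceReps : List Dart → Set
    FaceReps rs = Unique (map proj₁ rs)
      × (∀ d → Σ Dart λ r → r ∈ rs × SameFace r d)
      × (∀ r r' → r ∈ rs → r' ∈ rs → SameFace r r' → proj₁ r ≡ proj₁ r')

  Planar : Set
  Planar = (dartCount ≡ 0) ⊎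
    (Σ RotationSystem λ R → Σ (List Dart) λ rs →
       RotationSystem.FaceReps R rs ×
       2 * n G + 2 * length rs ≡ dartCount + 4)

-- Say that e cuts w off from t if w ∉ e and w, t lie in different components of G - e.
-- If e cuts off an endpoint c of a link f, every walk to t in G - e avoids f, since an
-- endpoint of f on it would join c to t. The only use of 2-connectivity is that each
-- node of a separating pair {a, b} has a neighbour in every component of G - {a, b};
-- applied to the component of t, it shows that an end of e off f reaches t in G - f.
-- Asymmetry and transitivity follow from these two facts. For (3), walk from an end
-- a ∉ f of e through a neighbour into the component of the endpoint of g cut off by e:
-- either the walk meets f, and then e cuts off an endpoint of f, or it avoids f, and
-- then f cuts a off.
{-# OPTIONS --safe #-}
module Submission where

open import Defs
open import Data.Bool using (T)
open import Data.Empty using (⊥-elim)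
open import Data.Fin using (_≟_)
open import Data.List using (List; _∷_)
open import Data.List.Membership.Propositional using (_∈_)
open import Data.List.Relation.Unary.Any using (here; there)
open import Data.Product using (Σ; _×_; _,_; proj₁; proj₂)
open import Data.Sum using (_⊎_; inj₁; inj₂; [_,_]; map₁)
open import Function using (_∘_)
open import Relation.Nullary using (¬_; Dec; yes; no)
open import Relation.Nullary.Decidable using (_⊎-dec_)
open import Relation.Binary.PropositionalEquality using (_≡_; refl; sym; trans; subst)

module Links (G : Graph) where

  private
    variable
      x y : Node G

  adj-sym : Adj G x y → Adj G y x
  adj-sym {x} {y} = subst T (symm G x y)

  infix 4 _∈ₗ_ _∉ₗ_ _∈ₗ?_

  _∈ₗ_ : Node G → Link G → Set
  u ∈ₗ e = IncidentTo G u e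

  _∉ₗ_ : Node G → Link G → Set
  u ∉ₗ e = ¬ u ∈ₗ e

  _∈ₗ?_ : (u : Node G) (e : Link G) → Dec (u ∈ₗ e)
  u ∈ₗ? e = (u ≟ end₁ e) ⊎-dec (u ≟ end₂ e)

  SameLink-sym : (e f : Link G) → SameLink G e f → SameLink G f e
  SameLink-sym _ _ (inj₁ (p , q)) = inj₁ (sym p , sym q)
  SameLink-sym _ _ (inj₂ (p , q)) = inj₂ (sym q , sym p)

  ends-distinct : (e : Link G) → ¬ end₁ e ≡ end₂ e
  ends-distinct e eq = irrefl G (end₁ e) (subst (Adj G (end₁ e)) (sym eq) (isAdj e))

  endpoint-off : (e f : Link G) → ¬ SameLink G e f → Σ (Node G) λ a → a ∈ₗ e × a ∉ₗ f
  endpoint-off e f e≢f with end₁ e ∈ₗ? f | end₂ e ∈ₗ? f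
  ... | no a∉f | _      = end₁ e , inj₁ refl , a∉f
  ... | yes _  | no a∉f = end₂ e , inj₂ refl , a∉f
  ... | yes (inj₁ p) | yes (inj₂ q) = ⊥-elim (e≢f (inj₁ (p , q)))
  ... | yes (inj₂ p) | yes (inj₁ q) = ⊥-elim (e≢f (inj₂ (p , q)))
  ... | yes (inj₁ p) | yes (inj₁ q) = ⊥-elim (ends-distinct e (trans p (sym q)))
  ... | yes (inj₂ p) | yes (inj₂ q) = ⊥-elim (ends-distinct e (trans p (sym q)))

module Avoidance (G : Graph) where

  open Links G

  private
    variable
      a b u w x y z : Node G
      xs P : List (Node G)
      e : Link G

  source-avoids : WalkAvoiding G a b x z → ¬ x ≡ a × ¬ x ≡ b
  source-avoids (here x≢a x≢b)     = x≢a , x≢b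
  source-avoids (step x≢a x≢b _ _) = x≢a , x≢b

  target-avoids : WalkAvoiding G a b x z → ¬ z ≡ a × ¬ z ≡ b
  target-avoids (here z≢a z≢b)  = z≢a , z≢b
  target-avoids (step _ _ _ xz) = target-avoids xz

  walk-trans : WalkAvoiding G a b x y → WalkAvoiding G a b y z → WalkAvoiding G a b x z
  walk-trans (here _ _)            yz = yz
  walk-trans (step x≢a x≢b xw wy) yz = step x≢a x≢b xw (walk-trans wy yz)

  walk-sym : WalkAvoiding G a b x z → WalkAvoiding G a b z x
  walk-sym (here x≢a x≢b) = here x≢a x≢b
  walk-sym (step x≢a x≢b xy yz) =
    walk-trans (walk-sym yz) (step y≢a y≢b (adj-sym xy) (here x≢a x≢b))
    where
    y≢a = proj₁ (source-avoids yz)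
    y≢b = proj₂ (source-avoids yz)

  walk-swap : WalkAvoiding G a b x z → WalkAvoiding G b a x z
  walk-swap (here x≢a x≢b)       = here x≢b x≢a
  walk-swap (step x≢a x≢b xy yz) = step x≢b x≢a xy (walk-swap yz)

  AdjacentToComponent : (a b z s : Node G) → Set
  AdjacentToComponent a b z s = Σ (Node G) λ y → Adj G s y × WalkAvoiding G a b y z

  last-visit : Chain G (x ∷ xs) → ¬ last G x xs ≡ a → ¬ last G x xs ≡ b →
    WalkAvoiding G a b x (last G x xs) ⊎
    Σ (Node G) λ s → s ∈ x ∷ xs × (s ≡ a ⊎ s ≡ b) × AdjacentToComponent a b (last G x xs) s
  last-visit (single _) z≢a z≢b = inj₁ (here z≢a z≢b)
  last-visit {a = a} {b = b} (cons x y _ xy chain) z≢a z≢b with last-visit chain z≢a z≢b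
  ... | inj₂ (s , s∈ , s∈ab , adjacent) = inj₂ (s , there s∈ , s∈ab , adjacent)
  ... | inj₁ yz with x ≟ a | x ≟ b
  ...   | yes x≡a | _       = inj₂ (x , here refl , inj₁ x≡a , y , xy , yz)
  ...   | no _    | yes x≡b = inj₂ (x , here refl , inj₂ x≡b , y , xy , yz)
  ...   | no x≢a  | no x≢b  = inj₁ (step x≢a x≢b xy yz)

  path-last-visit : IsPath G x z P → ¬ z ≡ a → ¬ z ≡ b →
    WalkAvoiding G a b x z ⊎
    Σ (Node G) λ s → s ∈ P × (s ≡ a ⊎ s ≡ b) × AdjacentToComponent a b z s
  path-last-visit {P = _ ∷ _} (chain , _ , refl , refl) = last-visit chain

  -- The last visits of two internally disjoint x–z paths to {a, b} cannot both be b.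
  separator-adjacent-to-component : TwoConnected G →
    ¬ x ≡ a → ¬ x ≡ b → ¬ z ≡ a → ¬ z ≡ b → ¬ WalkAvoiding G a b x z →
    AdjacentToComponent a b z a
  separator-adjacent-to-component {x} {z = z} 2-conn x≢a x≢b z≢a z≢b x≁z with x ≟ z
  ... | yes refl = ⊥-elim (x≁z (here x≢a x≢b))
  ... | no x≢z with 2-conn x z x≢z
  ... | _ , _ , path-P , path-Q , _ , disjoint
    with path-last-visit path-P z≢a z≢b | path-last-visit path-Q z≢a z≢b
  ... | inj₁ xz | _ = ⊥-elim (x≁z xz)
  ... | _ | inj₁ xz = ⊥-elim (x≁z xz)
  ... | inj₂ (_ , _ , inj₁ refl , adjacent) | _ = adjacent
  ... | _ | inj₂ (_ , _ , inj₁ refl , adjacent) = adjacent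
  ... | inj₂ (b , b∈P , inj₂ refl , _) | inj₂ (_ , b∈Q , inj₂ refl , _) =
    ⊥-elim ([ x≢b ∘ sym , z≢b ∘ sym ] (disjoint b b∈P b∈Q))

  infix 4 _~[_]_

  record _~[_]_ (x : Node G) (e : Link G) (z : Node G) : Set where
    constructor ⟨_⟩
    field
      walk : ConnectedIn- G (end₁ e) (end₂ e) x z

  open _~[_]_ public

  ~-refl : x ∉ₗ e → x ~[ e ] x
  ~-refl x∉e = ⟨ here (x∉e ∘ inj₁) (x∉e ∘ inj₂) ⟩

  ~-step : x ∉ₗ e → Adj G x y → y ~[ e ] z → x ~[ e ] z
  ~-step x∉e xy ⟨ yz ⟩ = ⟨ step (x∉e ∘ inj₁) (x∉e ∘ inj₂) xy yz ⟩

  ~-sym : x ~[ e ] z → z ~[ e ] x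
  ~-sym ⟨ xz ⟩ = ⟨ walk-sym xz ⟩

  ~-trans : x ~[ e ] y → y ~[ e ] z → x ~[ e ] z
  ~-trans ⟨ xy ⟩ ⟨ yz ⟩ = ⟨ walk-trans xy yz ⟩

  ~-source : x ~[ e ] z → x ∉ₗ e
  ~-source ⟨ xz ⟩ = [ proj₁ (source-avoids xz) , proj₂ (source-avoids xz) ]

  ~-target : x ~[ e ] z → z ∉ₗ e
  ~-target ⟨ xz ⟩ = [ proj₁ (target-avoids xz) , proj₂ (target-avoids xz) ]

  ~-endpoints : (h : Link G) → u ∈ₗ h → w ∈ₗ h → u ∉ₗ e → w ∉ₗ e → u ~[ e ] w
  ~-endpoints h (inj₁ refl) (inj₁ refl) u∉e _   = ~-refl u∉e
  ~-endpoints h (inj₁ refl) (inj₂ refl) u∉e w∉e = ~-step u∉e (isAdj h) (~-refl w∉e)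
  ~-endpoints h (inj₂ refl) (inj₁ refl) u∉e w∉e = ~-step u∉e (adj-sym (isAdj h)) (~-refl w∉e)
  ~-endpoints h (inj₂ refl) (inj₂ refl) u∉e _   = ~-refl u∉e

  ~-avoids-or-meets : (f : Link G) → x ~[ e ] z →
    x ~[ f ] z ⊎ Σ (Node G) λ u → u ∈ₗ f × u ~[ e ] z
  ~-avoids-or-meets {x} f xz with x ∈ₗ? f
  ~-avoids-or-meets {x} f xz             | yes x∈f = inj₂ (x , x∈f , xz)
  ~-avoids-or-meets f ⟨ here _ _ ⟩       | no x∉f  = inj₁ (~-refl x∉f)
  ~-avoids-or-meets f ⟨ step _ _ xy yz ⟩ | no x∉f  =
    map₁ (~-step x∉f xy) (~-avoids-or-meets f ⟨ yz ⟩)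

  endpoint-adjacent-to-component : TwoConnected G → a ∈ₗ e → x ∉ₗ e → z ∉ₗ e →
    ¬ x ~[ e ] z → Σ (Node G) λ y → Adj G a y × y ~[ e ] z
  endpoint-adjacent-to-component 2-conn (inj₁ refl) x∉e z∉e x≁z
    with separator-adjacent-to-component 2-conn
           (x∉e ∘ inj₁) (x∉e ∘ inj₂) (z∉e ∘ inj₁) (z∉e ∘ inj₂) (x≁z ∘ ⟨_⟩)
  ... | y , ay , yz = y , ay , ⟨ yz ⟩
  endpoint-adjacent-to-component 2-conn (inj₂ refl) x∉e z∉e x≁z
    with separator-adjacent-to-component 2-conn
           (x∉e ∘ inj₂) (x∉e ∘ inj₁) (z∉e ∘ inj₂) (z∉e ∘ inj₁) (x≁z ∘ ⟨_⟩ ∘ walk-swap)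
  ... | y , ay , yz = y , ay , ⟨ walk-swap yz ⟩

module Rooted (G : Graph) (t : Node G) where

  open Links G
  open Avoidance G

  private
    variable
      a c u w y : Node G
      e f : Link G

  record CutOff (e : Link G) (w : Node G) : Set where
    constructor cutOff
    field
      outside     : w ∉ₗ e
      unreachable : ¬ w ~[ e ] t

  cutOff-along : u ~[ e ] w → CutOff e w → CutOff e u
  cutOff-along uw (cutOff _ w≁t) = cutOff (~-source uw) (w≁t ∘ ~-trans (~-sym uw))

  cutOff-reroute : CutOff e c → c ∈ₗ f → y ~[ e ] t → y ~[ f ] t
  cutOff-reroute {f = f} (cutOff c∉e c≁t) c∈f yt with ~-avoids-or-meets f yt
  ... | inj₁ yt-avoiding-f  = yt-avoiding-f
  ... | inj₂ (u , u∈f , ut) =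
    ⊥-elim (c≁t (~-trans (~-endpoints f c∈f u∈f c∉e (~-source ut)) ut))

  endpoint-reaches-root : TwoConnected G → t ∉ₗ e → CutOff e c → c ∈ₗ f →
    a ∈ₗ e → a ∉ₗ f → a ~[ f ] t
  endpoint-reaches-root 2-conn t∉e cut@(cutOff c∉e c≁t) c∈f a∈e a∉f
    with endpoint-adjacent-to-component 2-conn a∈e c∉e t∉e c≁t
  ... | y , ay , yt = ~-step a∉f ay (cutOff-reroute cut c∈f yt)

  cutOff-trans : TwoConnected G → t ∉ₗ e → CutOff e c → c ∈ₗ f →
    CutOff f w → CutOff e w
  cutOff-trans 2-conn t∉e cut c∈f (cutOff w∉f w≁t) = cutOff
    (λ w∈e → w≁t (endpoint-reaches-root 2-conn t∉e cut c∈f w∈e w∉f))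
    (w≁t ∘ cutOff-reroute cut c∈f)

  cutOff-comparable : TwoConnected G → t ∉ₗ e → a ∈ₗ e → a ∉ₗ f →
    (g : Link G) → u ∈ₗ g → w ∈ₗ g → CutOff e u → CutOff f w →
    (Σ (Node G) λ c → c ∈ₗ f × CutOff e c) ⊎ CutOff f a
  cutOff-comparable {a = a} {f = f} {w = w} 2-conn t∉e a∈e a∉f g u∈g w∈g
                    cut₁@(cutOff u∉e u≁t) cut₂@(cutOff w∉f _)
    with endpoint-adjacent-to-component 2-conn a∈e t∉e u∉e (u≁t ∘ ~-sym)
  ... | y , ay , yu with ~-avoids-or-meets f yu
  ...   | inj₂ (c , c∈f , cu) = inj₁ (c , c∈f , cutOff-along cu cut₁)
  ...   | inj₁ yu-avoiding-f  = inj₂ (cutOff-along aw cut₂)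
    where
    aw : a ~[ f ] w
    aw = ~-trans (~-step a∉f ay yu-avoiding-f)
                 (~-endpoints g u∈g w∈g (~-target yu-avoiding-f) w∉f)

  InS-endpoint : (e h : Link G) → InS G t e h → Σ (Node G) λ c → c ∈ₗ h × CutOff e c
  InS-endpoint _ h (_ , _ , _ , inj₁ (_ , c∉e , _ , c≁t)) =
    end₁ h , inj₁ refl , cutOff c∉e (c≁t ∘ walk)
  InS-endpoint _ h (_ , _ , _ , inj₂ (_ , c∉e , _ , c≁t)) =
    end₂ h , inj₂ refl , cutOff c∉e (c≁t ∘ walk)

  InS-intro : (h : Link G) → Separating G e → t ∉ₗ e → ¬ SameLink G h e →
    c ∈ₗ h → CutOff e c → InS G t e h
  InS-intro _ sep t∉e h≢e (inj₁ refl) (cutOff c∉e c≁t) =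
    sep , t∉e , h≢e , inj₁ (sep , c∉e , t∉e , c≁t ∘ ⟨_⟩)
  InS-intro _ sep t∉e h≢e (inj₂ refl) (cutOff c∉e c≁t) =
    sep , t∉e , h≢e , inj₂ (sep , c∉e , t∉e , c≁t ∘ ⟨_⟩)

  InS-asym : TwoConnected G → (e f : Link G) → InS G t e f → ¬ InS G t f e
  InS-asym 2-conn e f e>f@(_ , t∉e , _) f>e
    with InS-endpoint e f e>f | InS-endpoint f e f>e
  ... | c , c∈f , cut | a , a∈e , cutOff a∉f a≁t =
    a≁t (endpoint-reaches-root 2-conn t∉e cut c∈f a∈e a∉f)

  InS-trans : TwoConnected G → (e f g : Link G) → ¬ SameLink G e g →
    InS G t e f → InS G t f g → InS G t e g
  InS-trans 2-conn e f g e≢g e>f@(sep , t∉e , _) f>g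
    with InS-endpoint e f e>f | InS-endpoint f g f>g
  ... | c , c∈f , cut | w , w∈g , cut′ =
    InS-intro g sep t∉e (e≢g ∘ SameLink-sym g e) w∈g
      (cutOff-trans 2-conn t∉e cut c∈f cut′)

  InS-comparable : TwoConnected G → (e f g : Link G) → ¬ SameLink G e f →
    InS G t e g → InS G t f g → InS G t e f ⊎ InS G t f e
  InS-comparable 2-conn e f g e≢f e>g@(sep-e , t∉e , _) f>g@(sep-f , t∉f , _)
    with InS-endpoint e g e>g | InS-endpoint f g f>g | endpoint-off e f e≢f
  ... | u , u∈g , cut₁ | w , w∈g , cut₂ | a , a∈e , a∉f
    with cutOff-comparable 2-conn t∉e a∈e a∉f g u∈g w∈g cut₁ cut₂
  ... | inj₁ (c , c∈f , cut) = inj₁ (InS-intro f sep-e t∉e (e≢f ∘ SameLink-sym f e) c∈f cut)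
  ... | inj₂ cut             = inj₂ (InS-intro e sep-f t∉f e≢f a∈e cut)

lemma6p11 : (G : Graph) (t : Node G) → TwoConnected G → Planar G →
    (e f g : Link G) →
    ¬ SameLink G e f → ¬ SameLink G e g → ¬ SameLink G f g →
    (InS G t e f → ¬ InS G t f e) ×
    (InS G t e f → InS G t f g → InS G t e g) ×
    (InS G t e g → InS G t f g → InS G t e f ⊎ InS G t f e)
lemma6p11 G t 2-conn _ e f g e≢f e≢g _ =
  InS-asym 2-conn e f ,
  InS-trans 2-conn e f g e≢g ,
  InS-comparable 2-conn e f g e≢f
  where open Rooted G t
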